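{- Let $n\ge 1$ and let $(\mathbf d,\mathbf r)$ be an arithmetical structure on the fan graph $F_n$, with $\mathbf d=(d_0,\dots,d_{2n})$, $\mathbf r=(r_0,\dots,r_{2n})$, such that $r_0$ divides $r_{2n-1}+r_{2n}$. Define vectors indexed by the vertices $v_0,\dots,v_{2n+2}$ of $F_{n+1}$ by $$\tilde{\mathbf d}=\Big(d_0+\tfrac{r_{2n-1}+r_{2n}}{r_0},\,d_1,\dots,d_{2n},\,d_{2n-1},\,d_{2n}\Big),\qquad \tilde{\mathbf r}=(r_0,r_1,\dots,r_{2n},r_{2n-1},r_{2n}).$$ Then $(\tilde{\mathbf d},\tilde{\mathbf r})$ is an arithmetical structure on $F_{n+1}$.
   Context: For $k\ge1$, the fan graph $F_k$ has vertices $v_0,\dots,v_{2k}$, with edges $v_0v_i$ for $1\le i\le 2k$ and $v_{2j-1}v_{2j}$ for $1\le j\le k$; the $i$-th entry (starting at $0$) of a vector corresponds to $v_i$. For a finite connected graph $G$ with adjacency matrix $A$, an arithmetical structure on $G$ is a pair $(\mathbf d,\mathbf r)$ of vectors of positive integers indexed by the vertices such that $\mathbf r$ is primitive (gcd of entries equal to $1$) and $(\mathrm{diag}(\mathbf d)-A)\mathbf r=0$. -}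

module Defs where

open import Data.Nat using (ℕ; zero; suc; _+_; _*_; _∸_; _≤_; _<_; _≟_; _<?_; _≤?_)
open import Data.Nat.ListAction using (sum)
open import Data.Product using (_×_)
open import Relation.Nullary using (yes; no)
open import Data.Nat.GCD using (gcd)
open import Data.Nat.Divisibility using (_∣_; quotient)
open import Data.Fin using (Fin; toℕ; fromℕ<)
open import Data.List using (List; foldr; map)
open import Data.List.Base using (allFin)
open import Data.Bool using (Bool; true; false; if_then_else_; _∧_; _∨_; not)
open import Relation.Nullary.Decidable using (⌊_⌋)
open import Relation.Binary.PropositionalEquality using (_≡_)

-- A graph on vertex set Fin m, given by its (0/1, symmetric) adjacency matrix
-- with natural-number entries.
AdjMatrix : ℕ → Set
AdjMatrix m = Fin m → Fin m → ℕ

-- ⌈ i / 2 ⌉ for i ≥ 1: vertices v_{2j-1}, v_{2j} both map to j.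
half : ℕ → ℕ
half zero = zero
half (suc zero) = suc zero
half (suc (suc i)) = suc (half i)

fanAdj : ℕ → ℕ → Bool
fanAdj zero zero = false
fanAdj zero (suc j) = true
fanAdj (suc i) zero = true
fanAdj (suc i) (suc j) =
  not ⌊ i ≟ j ⌋ ∧ ⌊ half (suc i) ≟ half (suc j) ⌋

-- The fan graph F_k, with vertices v_0, …, v_{2k} (= Fin (suc (2 * k))),
-- edges v_0 v_i (1 ≤ i ≤ 2k) and v_{2j-1} v_{2j} (1 ≤ j ≤ k).
fanGraph : (k : ℕ) → AdjMatrix (suc (2 * k))
fanGraph k i j = if fanAdj (toℕ i) (toℕ j) then 1 else 0

gcdVec : {m : ℕ} → (Fin m → ℕ) → ℕ
gcdVec {m} r = foldr gcd 0 (map r (allFin m))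

-- (diag(d) - A) r = 0, written entrywise over ℕ: d_i r_i = Σ_j A_ij r_j.
IsArithmetical : {m : ℕ} → AdjMatrix m → (Fin m → ℕ) → (Fin m → ℕ) → Set
IsArithmetical {m} A d r =
  ((i : Fin m) → 0 < d i) × ((i : Fin m) → 0 < r i) × (gcdVec r ≡ 1) ×
  ((i : Fin m) → d i * r i ≡ sum (map (λ j → A i j * r j) (allFin m)))

-- entry of a vector at a natural-number index (0 outside the range)
at : {m : ℕ} → (Fin m → ℕ) → ℕ → ℕ
at {m} v i with i <? m
... | yes p = v (fromℕ< p)
... | no _ = 0

-- The extended vectors on F_{n+1}: given x on F_n and a value x0' for v_0,
-- produce (x0', x_1, …, x_{2n}, x_{2n-1}, x_{2n}).
extendFan : (n : ℕ) → (Fin (suc (2 * n)) → ℕ) → ℕ → Fin (suc (2 * suc n)) → ℕ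
extendFan n x x0' i = ext (toℕ i)
  where
  ext : ℕ → ℕ
  ext zero = x0'
  ext (suc i') with suc i' ≤? 2 * n
  ... | yes _ = at x (suc i')
  ... | no _ with suc i' ≟ 2 * n + 1
  ...   | yes _ = at x (2 * n ∸ 1)
  ...   | no _ = at x (2 * n)

-- The blades of the fan are the pairs v_{2j-1} v_{2j}. The new vertices v_{2n+1}, v_{2n+2}
-- form a copy of the last blade v_{2n-1} v_{2n}: each sees only the hub and its partner, so
-- its equation is the equation of the vertex it copies. The vertices v_1, …, v_{2n} do not
-- see the new blade, so their equations are unchanged, and the hub gains
-- r_{2n-1} + r_{2n} = q r_0 on the right, which is balanced by raising d_0 by q. Finally,
-- every entry of r is an entry of r̃, so gcd r̃ divides gcd r = 1.
module Submission where

open import Defs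
open import Data.Nat using (ℕ; suc; _+_; _*_; _∸_; _≤_)
open import Data.Nat.Divisibility using (_∣_; quotient)
open import Data.Fin using (Fin)

open import Data.Bool using (if_then_else_; not)
open import Data.Bool.Properties using (∧-zeroʳ)
open import Data.Empty using (⊥-elim)
open import Data.Fin using (toℕ; fromℕ<; inject≤)
open import Data.Fin.Properties using (toℕ<n; fromℕ<-toℕ; toℕ-fromℕ<; toℕ-inject≤)
open import Data.List using ([]; _∷_; _++_; _∷ʳ_; map; foldr; tabulate; upTo; applyUpTo; allFin)
open import Data.List.Membership.Propositional using (_∈_)
open import Data.List.Membership.Propositional.Properties using (∈-map⁺; ∈-allFin)
open import Data.List.Properties
  using (map-++; map-∘; map-cong; map-cong-local; map-tabulate; map-upTo; upTo-∷ʳ)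
open import Data.List.Relation.Unary.All using (All; []; _∷_)
open import Data.List.Relation.Unary.All.Properties using (applyUpTo⁺₁; tabulate⁺; map⁺)
open import Data.List.Relation.Unary.Any using (here; there)
open import Data.Nat using (zero; _<_; z≤n; s≤s; z<s; s≤s⁻¹; s<s⁻¹)
open import Data.Nat.Divisibility using (divides; ∣-trans; _∣0; ∣1⇒≡1)
open import Data.Nat.GCD using (gcd; gcd[m,n]∣m; gcd[m,n]∣n; gcd-greatest)
open import Data.Nat.ListAction using (sum)
open import Data.Nat.ListAction.Properties using (sum-++)
open import Data.Nat.Properties
open import Data.Product using (_,_)
open import Function using (id; _∘_)
open import Relation.Binary.Definitions using (tri<; tri≈; tri>)
open import Relation.Binary.PropositionalEquality
  using (_≡_; _≢_; refl; sym; trans; cong; cong₂; subst; module ≡-Reasoning)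
open import Relation.Nullary using (yes; no)
open import Relation.Nullary.Decidable using (⌊_⌋)
open ≡-Reasoning

∑< : ℕ → (ℕ → ℕ) → ℕ
∑< m g = sum (map g (upTo m))

infix 2 ∑<
syntax ∑< m (λ j → e) = ∑[ j < m ] e

∑<-suc : ∀ m g → ∑< (suc m) g ≡ ∑< m g + g m
∑<-suc m g = begin
  sum (map g (upTo (suc m)))        ≡⟨ cong (sum ∘ map g) (upTo-∷ʳ m) ⟨
  sum (map g (upTo m ∷ʳ m))         ≡⟨ cong sum (map-++ g (upTo m) (m ∷ [])) ⟩
  sum (map g (upTo m) ++ g m ∷ [])  ≡⟨ sum-++ (map g (upTo m)) (g m ∷ []) ⟩
  ∑< m g + (g m + 0)                ≡⟨ cong (∑< m g +_) (+-identityʳ (g m)) ⟩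
  ∑< m g + g m                      ∎

∑<-head : ∀ m g → ∑< (suc m) g ≡ g 0 + ∑< m (g ∘ suc)
∑<-head m g = cong (λ xs → g 0 + sum xs) (begin
  map g (applyUpTo suc m)   ≡⟨ cong (map g) (map-upTo suc m) ⟨
  map g (map suc (upTo m))  ≡⟨ map-∘ (upTo m) ⟨
  map (g ∘ suc) (upTo m)    ∎)

∑<-cong : ∀ m {f g : ℕ → ℕ} → (∀ {j} → j < m → f j ≡ g j) → ∑< m f ≡ ∑< m g
∑<-cong m f≡g = cong sum (map-cong-local (applyUpTo⁺₁ id m f≡g))

∑<-≡0 : ∀ m {g : ℕ → ℕ} → (∀ {j} → j < m → g j ≡ 0) → ∑< m g ≡ 0
∑<-≡0 zero    g≡0 = refl
∑<-≡0 (suc m) g≡0 = trans (∑<-suc m _) (cong₂ _+_ (∑<-≡0 m (g≡0 ∘ m<n⇒m<1+n)) (g≡0 ≤-refl))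

tabulate-toℕ : ∀ m → tabulate {n = m} toℕ ≡ upTo m
tabulate-toℕ zero    = refl
tabulate-toℕ (suc m) = cong (0 ∷_) (begin
  tabulate (suc ∘ toℕ)    ≡⟨ map-tabulate toℕ suc ⟨
  map suc (tabulate toℕ)  ≡⟨ cong (map suc) (tabulate-toℕ m) ⟩
  map suc (upTo m)        ≡⟨ map-upTo suc m ⟩
  applyUpTo suc m         ∎)

sum-allFin : ∀ m {f : Fin m → ℕ} (g : ℕ → ℕ) → (∀ i → f i ≡ g (toℕ i)) →
             sum (map f (allFin m)) ≡ ∑< m g
sum-allFin m {f} g f≡g = cong sum (begin
  map f (allFin m)          ≡⟨ map-cong f≡g (allFin m) ⟩
  map (g ∘ toℕ) (allFin m)  ≡⟨ map-tabulate id (g ∘ toℕ) ⟩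
  tabulate (g ∘ toℕ)        ≡⟨ map-tabulate toℕ g ⟨
  map g (tabulate toℕ)      ≡⟨ cong (map g) (tabulate-toℕ m) ⟩
  map g (upTo m)            ∎)

foldr-gcd-∣ : ∀ {x xs} → x ∈ xs → foldr gcd 0 xs ∣ x
foldr-gcd-∣ (here refl)               = gcd[m,n]∣m _ _
foldr-gcd-∣ {xs = y ∷ _} (there x∈xs) = ∣-trans (gcd[m,n]∣n y _) (foldr-gcd-∣ x∈xs)

∣-foldr-gcd : ∀ {c xs} → All (c ∣_) xs → c ∣ foldr gcd 0 xs
∣-foldr-gcd []           = _ ∣0
∣-foldr-gcd (c∣x ∷ c∣xs) = gcd-greatest c∣x (∣-foldr-gcd c∣xs)

gcdVec-∣-reindex : ∀ {m m′} (s : Fin m′ → ℕ) (r : Fin m → ℕ) (ι : Fin m → Fin m′) →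
                   (∀ j → s (ι j) ≡ r j) → gcdVec s ∣ gcdVec r
gcdVec-∣-reindex s r ι s∘ι≡r = ∣-foldr-gcd (map⁺ (tabulate⁺ λ j →
  subst (gcdVec s ∣_) (s∘ι≡r j) (foldr-gcd-∣ (∈-map⁺ s (∈-allFin (ι j))))))

half-≤ : ∀ {m} j → j ≤ 2 * m → half j ≤ m
half-≤           zero          _   = z≤n
half-≤ {zero}    (suc j)       ()
half-≤ {suc m}   (suc zero)    _   = s≤s z≤n
half-≤ {suc m}   (suc (suc j)) j≤ =
  s≤s (half-≤ j (s≤s⁻¹ (s≤s⁻¹ (≤-trans j≤ (≤-reflexive (*-suc 2 m))))))

half-2m : ∀ m → half (2 * m) ≡ m
half-2m zero    = refl
half-2m (suc m) = trans (cong half (*-suc 2 m)) (cong suc (half-2m m))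

half-2m+1 : ∀ m → half (suc (2 * m)) ≡ suc m
half-2m+1 zero    = refl
half-2m+1 (suc m) = trans (cong (half ∘ suc) (*-suc 2 m)) (cong suc (half-2m+1 m))

half-2m+2 : ∀ m → half (suc (suc (2 * m))) ≡ suc m
half-2m+2 m = cong suc (half-2m m)

adj : ℕ → ℕ → ℕ
adj i j = if fanAdj i j then 1 else 0

adj-irrefl : ∀ i → adj i i ≡ 0
adj-irrefl zero = refl
adj-irrefl (suc i) with i ≟ i
... | yes _  = refl
... | no i≢i = ⊥-elim (i≢i refl)

adj-otherBlade : ∀ i j → half (suc i) ≢ half (suc j) → adj (suc i) (suc j) ≡ 0
adj-otherBlade i j blade≢ with half (suc i) ≟ half (suc j)
... | yes blade≡ = ⊥-elim (blade≢ blade≡)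
... | no _ rewrite ∧-zeroʳ (not ⌊ i ≟ j ⌋) = refl

adj-sameBlade : ∀ i j → i ≢ j → half (suc i) ≡ half (suc j) → adj (suc i) (suc j) ≡ 1
adj-sameBlade i j i≢j blade≡ with i ≟ j | half (suc i) ≟ half (suc j)
... | yes i≡j | _         = ⊥-elim (i≢j i≡j)
... | no _    | yes _     = refl
... | no _    | no blade≢ = ⊥-elim (blade≢ blade≡)

-- Rows are handled with ℕ-indexed vertices: this avoids casts between Fin (suc (2 * suc n))
-- and Fin (3 + 2 * n).
fanRowSum : ℕ → ℕ → (ℕ → ℕ) → ℕ
fanRowSum m k g = ∑[ j < suc (2 * m) ] adj k j * g j

FanRowEquations : ℕ → (ℕ → ℕ) → (ℕ → ℕ) → Set
FanRowEquations m d r = ∀ {k} → k < suc (2 * m) → d k * r k ≡ fanRowSum m k r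

fanRowSum-cong : ∀ m k {g h : ℕ → ℕ} → (∀ {j} → j < suc (2 * m) → g j ≡ h j) →
                 fanRowSum m k g ≡ fanRowSum m k h
fanRowSum-cong m k g≡h = ∑<-cong (suc (2 * m)) (λ j< → cong (adj k _ *_) (g≡h j<))

fanRowSum-suc : ∀ m k g → fanRowSum (suc m) k g ≡
  fanRowSum m k g + (adj k (suc (2 * m)) * g (suc (2 * m)) + adj k (suc (suc (2 * m))) * g (suc (suc (2 * m))))
fanRowSum-suc m k g = begin
  ∑< (suc (2 * suc m)) f  ≡⟨ cong (λ t → ∑< (suc t) f) (*-suc 2 m) ⟩
  ∑< (suc y) f            ≡⟨ ∑<-suc y f ⟩
  ∑< y f + f y            ≡⟨ cong (_+ f y) (∑<-suc x f) ⟩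
  ∑< x f + f x + f y      ≡⟨ +-assoc (∑< x f) (f x) (f y) ⟩
  ∑< x f + (f x + f y)    ∎
  where
  f : ℕ → ℕ
  f j = adj k j * g j
  x = suc (2 * m)
  y = suc x

fanRowSum-nextBlade : ∀ m i g → half (suc i) ≡ suc m → fanRowSum m (suc i) g ≡ g 0
fanRowSum-nextBlade m i g blade = begin
  fanRowSum m (suc i) g                                       ≡⟨ ∑<-head (2 * m) _ ⟩
  g 0 + 0 + (∑[ j < 2 * m ] adj (suc i) (suc j) * g (suc j))  ≡⟨ cong (g 0 + 0 +_) (∑<-≡0 (2 * m) unseen) ⟩
  g 0 + 0 + 0                                                 ≡⟨ cong (_+ 0) (+-identityʳ (g 0)) ⟩
  g 0 + 0                                                     ≡⟨ +-identityʳ (g 0) ⟩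
  g 0                                                         ∎
  where
  unseen : ∀ {j} → j < 2 * m → adj (suc i) (suc j) * g (suc j) ≡ 0
  unseen {j} j< = cong (_* g (suc j)) (adj-otherBlade i j λ blade≡ →
    <⇒≢ (s≤s (half-≤ (suc j) j<)) (trans (sym blade≡) blade))

fanRowSum-lastOdd : ∀ m g → fanRowSum (suc m) (suc (2 * m)) g ≡ g 0 + g (suc (suc (2 * m)))
fanRowSum-lastOdd m g = begin
  fanRowSum (suc m) x g                              ≡⟨ fanRowSum-suc m x g ⟩
  fanRowSum m x g + (adj x x * g x + adj x y * g y)  ≡⟨ cong₂ (λ s a → s + (a * g x + adj x y * g y))
                                                          (fanRowSum-nextBlade m (2 * m) g (half-2m+1 m))
                                                          (adj-irrefl x) ⟩
  g 0 + adj x y * g y                                ≡⟨ cong (λ a → g 0 + a * g y)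
                                                          (adj-sameBlade (2 * m) x (<⇒≢ ≤-refl)
                                                            (trans (half-2m+1 m) (sym (half-2m+2 m)))) ⟩
  g 0 + (g y + 0)                                    ≡⟨ cong (g 0 +_) (+-identityʳ (g y)) ⟩
  g 0 + g y                                          ∎
  where
  x = suc (2 * m)
  y = suc x

fanRowSum-lastEven : ∀ m g → fanRowSum (suc m) (suc (suc (2 * m))) g ≡ g 0 + g (suc (2 * m))
fanRowSum-lastEven m g = begin
  fanRowSum (suc m) y g                              ≡⟨ fanRowSum-suc m y g ⟩
  fanRowSum m y g + (adj y x * g x + adj y y * g y)  ≡⟨ cong₂ (λ s a → s + (adj y x * g x + a * g y))
                                                          (fanRowSum-nextBlade m x g (half-2m+2 m))
                                                          (adj-irrefl y) ⟩
  g 0 + (adj y x * g x + 0)                          ≡⟨ cong (λ a → g 0 + (a * g x + 0))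
                                                          (adj-sameBlade x (2 * m) (<⇒≢ ≤-refl ∘ sym)
                                                            (trans (half-2m+2 m) (sym (half-2m+1 m)))) ⟩
  g 0 + (g x + 0 + 0)                                ≡⟨ cong (g 0 +_) (trans (+-identityʳ _) (+-identityʳ (g x))) ⟩
  g 0 + g x                                          ∎
  where
  x = suc (2 * m)
  y = suc x

fanRowSum-2n∸1 : ∀ {n} → 1 ≤ n → ∀ g → fanRowSum n (2 * n ∸ 1) g ≡ g 0 + g (2 * n)
fanRowSum-2n∸1 {suc n} _ g =
  subst (λ t → fanRowSum (suc n) (t ∸ 1) g ≡ g 0 + g t) (sym (*-suc 2 n)) (fanRowSum-lastOdd n g)

fanRowSum-2n : ∀ {n} → 1 ≤ n → ∀ g → fanRowSum n (2 * n) g ≡ g 0 + g (2 * n ∸ 1)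
fanRowSum-2n {suc n} _ g =
  subst (λ t → fanRowSum (suc n) t g ≡ g 0 + g (t ∸ 1)) (sym (*-suc 2 n)) (fanRowSum-lastEven n g)

at-fromℕ< : ∀ {m k} (x : Fin m → ℕ) (k<m : k < m) → at x k ≡ x (fromℕ< k<m)
at-fromℕ< {m} {k} x k<m with k <? m
... | yes _  = refl
... | no k≮m = ⊥-elim (k≮m k<m)

at-toℕ : ∀ {m} (x : Fin m → ℕ) i → at x (toℕ i) ≡ x i
at-toℕ x i = trans (at-fromℕ< x (toℕ<n i)) (cong x (fromℕ<-toℕ i (toℕ<n i)))

-- A copy of the local function behind extendFan, which Defs does not export.
extendFanℕ : ℕ → (ℕ → ℕ) → ℕ → ℕ → ℕ
extendFanℕ n x c zero = c
extendFanℕ n x c (suc i) with suc i ≤? 2 * n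
... | yes _ = x (suc i)
... | no _ with suc i ≟ 2 * n + 1
...   | yes _ = x (2 * n ∸ 1)
...   | no _  = x (2 * n)

extendFan-toℕ : ∀ n x c i → extendFan n x c i ≡ extendFanℕ n (at x) c (toℕ i)
extendFan-toℕ n x c i with toℕ i
... | zero = refl
... | suc k with suc k ≤? 2 * n
...   | yes _ = refl
...   | no _ with suc k ≟ 2 * n + 1
...     | yes _ = refl
...     | no _  = refl

extendFanℕ-old : ∀ n x c {k} → suc k ≤ 2 * n → extendFanℕ n x c (suc k) ≡ x (suc k)
extendFanℕ-old n x c {k} k≤ with suc k ≤? 2 * n
... | yes _ = refl
... | no k≰ = ⊥-elim (k≰ k≤)

extendFanℕ-2n+1 : ∀ n x c → extendFanℕ n x c (suc (2 * n)) ≡ x (2 * n ∸ 1)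
extendFanℕ-2n+1 n x c with suc (2 * n) ≤? 2 * n
... | yes 2n+1≤2n = ⊥-elim (<-irrefl refl 2n+1≤2n)
... | no _ with suc (2 * n) ≟ 2 * n + 1
...   | yes _    = refl
...   | no 2n+1≢ = ⊥-elim (2n+1≢ (+-comm 1 (2 * n)))

extendFanℕ-2n+2 : ∀ n x c → extendFanℕ n x c (suc (suc (2 * n))) ≡ x (2 * n)
extendFanℕ-2n+2 n x c with suc (suc (2 * n)) ≤? 2 * n
... | yes 2n+1<2n = ⊥-elim (<-asym (n<1+n _) 2n+1<2n)
... | no _ with suc (suc (2 * n)) ≟ 2 * n + 1
...   | yes 2n+2≡ = ⊥-elim (<⇒≢ (n<1+n _) (trans (+-comm 1 (2 * n)) (sym 2n+2≡)))
...   | no _      = refl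

extendFanℕ-agrees : ∀ n x {k} → k < suc (2 * n) → extendFanℕ n x (x 0) k ≡ x k
extendFanℕ-agrees n x {zero}  _   = refl
extendFanℕ-agrees n x {suc k} k< = extendFanℕ-old n x (x 0) (s<s⁻¹ k<)

data ExtendedFanVertex (n : ℕ) : ℕ → Set where
  hub  : ExtendedFanVertex n 0
  old  : ∀ {k} → suc k ≤ 2 * n → ExtendedFanVertex n (suc k)
  new₁ : ExtendedFanVertex n (suc (2 * n))
  new₂ : ExtendedFanVertex n (suc (suc (2 * n)))

extendedFanVertex : ∀ n {k} → k < suc (2 * suc n) → ExtendedFanVertex n k
extendedFanVertex n {zero}  _   = hub
extendedFanVertex n {suc k} k< with <-cmp (suc k) (suc (2 * n))
... | tri< k<2n+1 _ _ = old (s<s⁻¹ k<2n+1)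
... | tri≈ _ refl _   = new₁
... | tri> _ _ 2n+1<k with ≤-antisym 2n+1<k (≤-trans (s<s⁻¹ k<) (≤-reflexive (*-suc 2 n)))
...   | refl = new₂

extendFanℕ-preserves : ∀ (P : ℕ → Set) n {x c} → P c → (∀ {k} → k < suc (2 * n) → P (x k)) →
                       ∀ {k} → k < suc (2 * suc n) → P (extendFanℕ n x c k)
extendFanℕ-preserves P n {x} {c} Pc Px k< with extendedFanVertex n k<
... | hub      = Pc
... | old k≤2n = subst P (sym (extendFanℕ-old n x c k≤2n)) (Px (s≤s k≤2n))
... | new₁     = subst P (sym (extendFanℕ-2n+1 n x c)) (Px (s≤s (m∸n≤m (2 * n) 1)))
... | new₂     = subst P (sym (extendFanℕ-2n+2 n x c)) (Px ≤-refl)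

extendFan-positive : ∀ n x c → 0 < c → (∀ j → 0 < x j) → ∀ i → 0 < extendFan n x c i
extendFan-positive n x c c>0 x>0 i = subst (0 <_) (sym (extendFan-toℕ n x c i))
  (extendFanℕ-preserves (0 <_) n c>0 (λ k< → subst (0 <_) (sym (at-fromℕ< x k<)) (x>0 _)) (toℕ<n i))

gcdVec-extendFan : ∀ n (r : Fin (suc (2 * n)) → ℕ) → gcdVec (extendFan n r (at r 0)) ∣ gcdVec r
gcdVec-extendFan n r = gcdVec-∣-reindex (extendFan n r r₀) r (λ j → inject≤ j F≤) λ j → begin
  extendFan n r r₀ (inject≤ j F≤)            ≡⟨ extendFan-toℕ n r r₀ (inject≤ j F≤) ⟩
  extendFanℕ n (at r) r₀ (toℕ (inject≤ j F≤)) ≡⟨ cong (extendFanℕ n (at r) r₀) (toℕ-inject≤ j F≤) ⟩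
  extendFanℕ n (at r) r₀ (toℕ j)              ≡⟨ extendFanℕ-agrees n (at r) (toℕ<n j) ⟩
  at r (toℕ j)                                ≡⟨ at-toℕ r j ⟩
  r j                                         ∎
  where
  r₀ = at r 0
  F≤ : suc (2 * n) ≤ suc (2 * suc n)
  F≤ = s≤s (*-monoʳ-≤ 2 (n≤1+n n))

fanGraph-rowSum : ∀ m (r : Fin (suc (2 * m)) → ℕ) (R : ℕ → ℕ) → (∀ j → r j ≡ R (toℕ j)) →
                  ∀ i → sum (map (λ j → fanGraph m i j * r j) (allFin _)) ≡ fanRowSum m (toℕ i) R
fanGraph-rowSum m r R r≡R i = sum-allFin _ _ (λ j → cong (fanGraph m i j *_) (r≡R j))

fanRowEquations-at : ∀ m (d r : Fin (suc (2 * m)) → ℕ) →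
  (∀ i → d i * r i ≡ sum (map (λ j → fanGraph m i j * r j) (allFin _))) →
  FanRowEquations m (at d) (at r)
fanRowEquations-at m d r rows {k} k< = begin
  at d k * at r k                                    ≡⟨ cong₂ _*_ (at-fromℕ< d k<) (at-fromℕ< r k<) ⟩
  d i * r i                                          ≡⟨ rows i ⟩
  sum (map (λ j → fanGraph m i j * r j) (allFin _))  ≡⟨ fanGraph-rowSum m r (at r) (sym ∘ at-toℕ r) i ⟩
  fanRowSum m (toℕ i) (at r)                         ≡⟨ cong (λ t → fanRowSum m t (at r)) (toℕ-fromℕ< k<) ⟩
  fanRowSum m k (at r)                               ∎
  where
  i = fromℕ< k<

fanRowEquations-toℕ : ∀ m (d r : Fin (suc (2 * m)) → ℕ) (D R : ℕ → ℕ) →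
  (∀ i → d i ≡ D (toℕ i)) → (∀ i → r i ≡ R (toℕ i)) → FanRowEquations m D R →
  ∀ i → d i * r i ≡ sum (map (λ j → fanGraph m i j * r j) (allFin _))
fanRowEquations-toℕ m d r D R d≡D r≡R rows i = begin
  d i * r i                                          ≡⟨ cong₂ _*_ (d≡D i) (r≡R i) ⟩
  D (toℕ i) * R (toℕ i)                              ≡⟨ rows (toℕ<n i) ⟩
  fanRowSum m (toℕ i) R                              ≡⟨ fanGraph-rowSum m r R r≡R i ⟨
  sum (map (λ j → fanGraph m i j * r j) (allFin _))  ∎

extendFanℕ-rowSum : ∀ n R k → fanRowSum (suc n) k (extendFanℕ n R (R 0)) ≡
  fanRowSum n k R + (adj k (suc (2 * n)) * R (2 * n ∸ 1) + adj k (suc (suc (2 * n))) * R (2 * n))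
extendFanℕ-rowSum n R k = begin
  fanRowSum (suc n) k R̃                                  ≡⟨ fanRowSum-suc n k R̃ ⟩
  fanRowSum n k R̃ + (adj k x * R̃ x + adj k y * R̃ y)      ≡⟨ cong₂ _+_ (fanRowSum-cong n k (extendFanℕ-agrees n R))
                                                              (cong₂ (λ a b → adj k x * a + adj k y * b)
                                                                (extendFanℕ-2n+1 n R (R 0))
                                                                (extendFanℕ-2n+2 n R (R 0))) ⟩
  fanRowSum n k R + (adj k x * R (2 * n ∸ 1) + adj k y * R (2 * n)) ∎
  where
  R̃ = extendFanℕ n R (R 0)
  x = suc (2 * n)
  y = suc x

extendFanℕ-rows : ∀ n → 1 ≤ n → (D R : ℕ → ℕ) (q : ℕ) → R (2 * n ∸ 1) + R (2 * n) ≡ q * R 0 →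
  FanRowEquations n D R → FanRowEquations (suc n) (extendFanℕ n D (D 0 + q)) (extendFanℕ n R (R 0))
extendFanℕ-rows n 1≤n D R q lastBlade rows k< = row (extendedFanVertex n k<)
  where
  D̃ R̃ : ℕ → ℕ
  D̃ = extendFanℕ n D (D 0 + q)
  R̃ = extendFanℕ n R (R 0)

  row : ∀ {k} → ExtendedFanVertex n k → D̃ k * R̃ k ≡ fanRowSum (suc n) k R̃
  row hub = begin
    (D 0 + q) * R 0                                        ≡⟨ *-distribʳ-+ (R 0) (D 0) q ⟩
    D 0 * R 0 + q * R 0                                    ≡⟨ cong₂ _+_ (rows z<s) (sym lastBlade) ⟩
    fanRowSum n 0 R + (R (2 * n ∸ 1) + R (2 * n))          ≡⟨ cong (fanRowSum n 0 R +_)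
                                                                (cong₂ _+_ (*-identityˡ _) (*-identityˡ (R (2 * n)))) ⟨
    fanRowSum n 0 R + (1 * R (2 * n ∸ 1) + 1 * R (2 * n))  ≡⟨ extendFanℕ-rowSum n R 0 ⟨
    fanRowSum (suc n) 0 R̃                                  ∎
  row (old {k} k≤2n) = begin
    D̃ (suc k) * R̃ (suc k)                                  ≡⟨ cong₂ _*_ (extendFanℕ-old n D (D 0 + q) k≤2n)
                                                                (extendFanℕ-old n R (R 0) k≤2n) ⟩
    D (suc k) * R (suc k)                                  ≡⟨ rows (s≤s k≤2n) ⟩
    fanRowSum n (suc k) R                                  ≡⟨ +-identityʳ _ ⟨
    fanRowSum n (suc k) R + (0 * R (2 * n ∸ 1) + 0 * R (2 * n))
                                                           ≡⟨ cong (fanRowSum n (suc k) R +_)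
                                                                (cong₂ (λ a b → a * R (2 * n ∸ 1) + b * R (2 * n))
                                                                  (unseen (half-2m+1 n)) (unseen (half-2m+2 n))) ⟨
    fanRowSum n (suc k) R + (adj (suc k) (suc (2 * n)) * R (2 * n ∸ 1) + adj (suc k) (suc (suc (2 * n))) * R (2 * n))
                                                           ≡⟨ extendFanℕ-rowSum n R (suc k) ⟨
    fanRowSum (suc n) (suc k) R̃                            ∎
    where
    unseen : ∀ {j} → half (suc j) ≡ suc n → adj (suc k) (suc j) ≡ 0
    unseen blade = adj-otherBlade k _ λ blade≡ → <⇒≢ (s≤s (half-≤ (suc k) k≤2n)) (trans blade≡ blade)
  row new₁ = begin
    D̃ (suc (2 * n)) * R̃ (suc (2 * n))                      ≡⟨ cong₂ _*_ (extendFanℕ-2n+1 n D (D 0 + q))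
                                                                (extendFanℕ-2n+1 n R (R 0)) ⟩
    D (2 * n ∸ 1) * R (2 * n ∸ 1)                          ≡⟨ rows (s≤s (m∸n≤m (2 * n) 1)) ⟩
    fanRowSum n (2 * n ∸ 1) R                              ≡⟨ fanRowSum-2n∸1 1≤n R ⟩
    R 0 + R (2 * n)                                        ≡⟨ cong (R 0 +_) (extendFanℕ-2n+2 n R (R 0)) ⟨
    R̃ 0 + R̃ (suc (suc (2 * n)))                            ≡⟨ fanRowSum-lastOdd n R̃ ⟨
    fanRowSum (suc n) (suc (2 * n)) R̃                      ∎
  row new₂ = begin
    D̃ (suc (suc (2 * n))) * R̃ (suc (suc (2 * n)))          ≡⟨ cong₂ _*_ (extendFanℕ-2n+2 n D (D 0 + q))
                                                                (extendFanℕ-2n+2 n R (R 0)) ⟩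
    D (2 * n) * R (2 * n)                                  ≡⟨ rows ≤-refl ⟩
    fanRowSum n (2 * n) R                                  ≡⟨ fanRowSum-2n 1≤n R ⟩
    R 0 + R (2 * n ∸ 1)                                    ≡⟨ cong (R 0 +_) (extendFanℕ-2n+1 n R (R 0)) ⟨
    R̃ 0 + R̃ (suc (2 * n))                                  ≡⟨ fanRowSum-lastEven n R̃ ⟨
    fanRowSum (suc n) (suc (suc (2 * n))) R̃                ∎

mainTheorem6 : (n : ℕ) → 1 ≤ n →
    (d r : Fin (suc (2 * n)) → ℕ) →
    IsArithmetical (fanGraph n) d r →
    (div : at r 0 ∣ (at r (2 * n ∸ 1) + at r (2 * n))) →
    IsArithmetical (fanGraph (suc n))
      (extendFan n d (at d 0 + quotient div))
      (extendFan n r (at r 0))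
mainTheorem6 n 1≤n d r (d>0 , r>0 , gcd[r]≡1 , rows) (divides q lastBlade) =
    extendFan-positive n d (at d 0 + q) (≤-trans (d>0 _) (m≤m+n _ q)) d>0
  , extendFan-positive n r (at r 0) (r>0 _) r>0
  , ∣1⇒≡1 (subst (gcdVec (extendFan n r (at r 0)) ∣_) gcd[r]≡1 (gcdVec-extendFan n r))
  , fanRowEquations-toℕ (suc n) _ _ (extendFanℕ n (at d) (at d 0 + q)) (extendFanℕ n (at r) (at r 0))
      (extendFan-toℕ n d (at d 0 + q)) (extendFan-toℕ n r (at r 0))
      (extendFanℕ-rows n 1≤n (at d) (at r) q lastBlade (fanRowEquations-at n d r rows))
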